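{- For every integer $n\ge0$, the number of partitions into an even number of distinct parts $\lambda_1>\lambda_2>\cdots>\lambda_{2l}$ (with $l\ge 0$) whose odd-indexed parts sum to $n$, i.e. $\lambda_1+\lambda_3+\cdots+\lambda_{2l-1}=n$, equals the number of partitions of $n$ with non-negative crank.
   Context: A partition is a finite weakly decreasing sequence of positive integers; the empty partition (zero parts) counts as a partition into an even number of distinct parts with odd-indexed sum $0$. The crank of a partition $\pi$ (Andrews–Garvan) is: if $1$ is not a part of $\pi$, the largest part of $\pi$ (taken to be $0$ for the empty partition); otherwise $\mu(\pi)-\omega(\pi)$, where $\omega(\pi)$ is the number of parts equal to $1$ and $\mu(\pi)$ is the number of parts larger than $\omega(\pi)$. -}

module Defs where

open import Data.Nat using (ℕ; zero; suc; _+_; _*_; _≤_; _<_; _≥_; _>_; _⊔_; _≟_; _<?_)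
open import Data.Integer using (ℤ; +_; _-_)
open import Data.List using (List; []; _∷_; length; filter)
open import Data.List.Relation.Unary.All using (All)
open import Data.List.Relation.Unary.Linked using (Linked)
open import Data.Product using (Σ; _×_)
open import Relation.Binary.PropositionalEquality using (_≡_)
open import Relation.Nullary.Decidable using (⌊_⌋)

IsPartition : List ℕ → Set
IsPartition xs = Linked _≥_ xs × All (λ x → 1 ≤ x) xs

IsDistinctPartition : List ℕ → Set
IsDistinctPartition xs = Linked _>_ xs × All (λ x → 1 ≤ x) xs

HasEvenLength : List ℕ → Set
HasEvenLength xs = Σ ℕ (λ l → length xs ≡ 2 * l)

oddIndexedSum : List ℕ → ℕ
oddIndexedSum [] = 0
oddIndexedSum (x ∷ []) = x
oddIndexedSum (x ∷ _ ∷ r) = x + oddIndexedSum r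

largestPart : List ℕ → ℕ
largestPart [] = 0
largestPart (x ∷ r) = x ⊔ largestPart r

ω : List ℕ → ℕ
ω xs = length (filter (λ x → x ≟ 1) xs)

μ : List ℕ → ℕ
μ xs = length (filter (λ x → ω xs <? x) xs)

crank : List ℕ → ℤ
crank xs with ω xs
... | zero  = + largestPart xs
... | suc _ = + μ xs - + ω xs

module Submission where

-- Both sets are put in bijection with lists of pairs (u₁,v₁) ⋯ (u_l,v_l) of naturals
-- of weight  l(l+1) + Σ i·uᵢ + Σ i·vᵢ = n.
--
-- Distinct side: λ_{2i} − λ_{2i+1} = vᵢ + 1 and λ_{2i−1} − λ_{2i} = uᵢ + 1 (with
-- λ_{2l+1} = 0), so that λ₁ + λ₃ + ⋯ = Σ i·(uᵢ + vᵢ + 2) is the weight.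
--
-- Crank side: the rows of π are its leading parts with πᵢ ≥ i+1; if there are l of
-- them they are all ≥ l+1 and the remaining small part σ has parts ≤ l+1.  The rows
-- are l+1 + (uᵢ + ⋯ + u_l), and σ, with multiplicities mₖ, is coded by
-- v₁ = m₁ + (l+1)·m_{l+1} and vₖ = mₖ (2 ≤ k ≤ l).  This code is invertible exactly
-- when m₁ ≤ l, and since every row exceeds l while σ stays ≤ l+1, the condition
-- m₁ ≤ l is equivalent to crank π ≥ 0.

open import Defs
open import Data.Nat using (ℕ; zero; suc; _+_; _*_; _∸_; _≤_; _<_; _≥_; _>_; z≤n; s≤s; _≟_; _<?_; _≤?_; pred; _/_; _%_; NonZero)
open import Data.Nat.Properties
open import Data.Nat.DivMod using (m≡m%n+[m/n]*n; m%n<n; [m+kn]%n≡m%n; m<n⇒m%n≡m; m<n⇒m/n≡0; +-distrib-/-∣ʳ; m*n/n≡m)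
open import Data.Nat.Divisibility using (n∣m*n)
open import Data.Nat.ListAction using (sum)
open import Data.Nat.ListAction.Properties using (sum-++)
open import Data.Nat.Tactic.RingSolver using (solve-∀)
open import Data.List using (List; []; _∷_; length; filter; map; _++_; replicate; zip; unzip)
open import Data.List.Properties using (length-map; length-++; length-replicate; length-filter; map-∘; map-id; map-id-local; filter-++; filter-all; filter-none; filter-accept; filter-reject; ++-identityʳ; zip-unzip; unzip-zip)
open import Data.List.Relation.Unary.All as All using (All; []; _∷_)
import Data.List.Relation.Unary.All.Properties as AllP
open import Data.List.Relation.Unary.Linked as Linked using (Linked; []; [-]; _∷_)
import Data.List.Relation.Unary.Linked.Properties as LinkedP
open import Data.Integer as ℤ using (ℤ)
import Data.Integer.Properties as ℤP
open import Data.Product using (Σ; _×_; _,_; proj₁; proj₂)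
open import Data.Sum using (_⊎_; inj₁; inj₂)
open import Data.Empty using (⊥-elim)
open import Function.Bundles using (_↔_; mk↔ₛ′)
open import Function.Construct.Composition using (_↔-∘_)
open import Relation.Binary.PropositionalEquality
open import Relation.Nullary using (Dec; yes; no)

IsPropValued : {X : Set} → (X → Set) → Set
IsPropValued P = ∀ {x} (p q : P x) → p ≡ q

Σ-≡ : {X : Set} {P : X → Set} → IsPropValued P →
      {x x′ : X} → x ≡ x′ → (p : P x) (p′ : P x′) → _≡_ {A = Σ X P} (x , p) (x′ , p′)
Σ-≡ irr refl p p′ = cong (_ ,_) (irr p p′)

subset-↔ : {X Y : Set} {P : X → Set} {Q : Y → Set} →
           IsPropValued P → IsPropValued Q →
           (f : X → Y) (g : Y → X) →
           (∀ {x} → P x → Q (f x)) → (∀ {y} → Q y → P (g y)) →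
           (∀ {x} → P x → g (f x) ≡ x) → (∀ {y} → Q y → f (g y) ≡ y) →
           Σ X P ↔ Σ Y Q
subset-↔ {P = P} {Q = Q} irrP irrQ f g fP gQ gf fg =
  mk↔ₛ′ (λ (x , p) → f x , fP p) (λ (y , q) → g y , gQ q)
    (λ (y , q) → Σ-≡ {P = Q} irrQ (fg q) _ q)
    (λ (x , p) → Σ-≡ {P = P} irrP (gf p) _ p)

headOr0 : List ℕ → ℕ
headOr0 [] = 0
headOr0 (x ∷ _) = x

Decreasing : List ℕ → Set
Decreasing = Linked _≥_

decreasing⇒bounded : ∀ {b x xs} → Decreasing (x ∷ xs) → x ≤ b → All (_≤ b) (x ∷ xs)
decreasing⇒bounded d x≤b = LinkedP.Linked⇒All (λ p q → ≤-trans q p) x≤b d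

headOr0-≤ : ∀ {x xs} → Decreasing (x ∷ xs) → headOr0 xs ≤ x
headOr0-≤ {xs = []} _ = z≤n
headOr0-≤ {xs = _ ∷ _} (x≥y ∷ _) = x≥y

++-decreasing : ∀ {b xs ys} → Decreasing xs → Decreasing ys →
                All (b ≤_) xs → All (_≤ b) ys → Decreasing (xs ++ ys)
++-decreasing [] dy _ _ = dy
++-decreasing {ys = []} [-] _ _ _ = [-]
++-decreasing {ys = _ ∷ _} [-] dy (b≤x ∷ _) (y≤b ∷ _) = ≤-trans y≤b b≤x ∷ dy
++-decreasing (x≥y ∷ dx) dy (_ ∷ bx) by = x≥y ∷ ++-decreasing dx dy bx by

decreasing-++ˡ : ∀ xs {ys} → Decreasing (xs ++ ys) → Decreasing xs
decreasing-++ˡ [] _ = []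
decreasing-++ˡ (x ∷ []) _ = [-]
decreasing-++ˡ (x ∷ y ∷ xs) (x≥y ∷ d) = x≥y ∷ decreasing-++ˡ (y ∷ xs) d

decreasing-++ʳ : ∀ xs {ys} → Decreasing (xs ++ ys) → Decreasing ys
decreasing-++ʳ [] d = d
decreasing-++ʳ (x ∷ xs) d = decreasing-++ʳ xs (Linked.tail d)

map-decreasing : ∀ {f : ℕ → ℕ} → (∀ {x y} → y ≤ x → f y ≤ f x) →
                 ∀ {xs} → Decreasing xs → Decreasing (map f xs)
map-decreasing mono d = LinkedP.map⁺ (Linked.map mono d)

replicate-decreasing : ∀ n x → Decreasing (replicate n x)
replicate-decreasing zero x = []
replicate-decreasing (suc zero) x = [-]
replicate-decreasing (suc (suc n)) x = ≤-refl ∷ replicate-decreasing (suc n) x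

sum-replicate : ∀ q k → sum (replicate q k) ≡ q * k
sum-replicate zero k = refl
sum-replicate (suc q) k = cong (k +_) (sum-replicate q k)

sum-map-+ : ∀ k xs → sum (map (k +_) xs) ≡ length xs * k + sum xs
sum-map-+ k [] = refl
sum-map-+ k (x ∷ xs) rewrite sum-map-+ k xs = shift k x (length xs) (sum xs)
  where
  shift : ∀ k x l s → k + x + (l * k + s) ≡ k + l * k + (x + s)
  shift = solve-∀

-- weightedSum (c₁ ∷ c₂ ∷ ⋯ ∷ c_l) = 1·c₁ + 2·c₂ + ⋯ + l·c_l, the sum of all suffix sums.
weightedSum : List ℕ → ℕ
weightedSum [] = 0
weightedSum (c ∷ cs) = sum (c ∷ cs) + weightedSum cs

Pairs : Set
Pairs = List (ℕ × ℕ)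

firsts : Pairs → List ℕ
firsts M = proj₁ (unzip M)

seconds : Pairs → List ℕ
seconds M = proj₂ (unzip M)

length-firsts : ∀ M → length (firsts M) ≡ length M
length-firsts [] = refl
length-firsts (_ ∷ M) = cong suc (length-firsts M)

length-seconds : ∀ M → length (seconds M) ≡ length M
length-seconds [] = refl
length-seconds (_ ∷ M) = cong suc (length-seconds M)

pairWeight : Pairs → ℕ
pairWeight M = weightedSum (firsts M) + weightedSum (seconds M) + length M * suc (length M)

PairsOfWeight : ℕ → Set
PairsOfWeight n = Σ Pairs (λ M → pairWeight M ≡ n)

-- A pair list M encodes the partition whose parts
-- are read off from the end: λ_{2i} = (vᵢ+1) + (sum of all later increments),
-- λ_{2i-1} = (uᵢ+1) + λ_{2i}.  pairTotal M is the largest part so produced.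
pairTotal : Pairs → ℕ
pairTotal [] = 0
pairTotal ((u , v) ∷ M) = suc u + (suc v + pairTotal M)

pairsToDistinct : Pairs → List ℕ
pairsToDistinct [] = []
pairsToDistinct ((u , v) ∷ M) =
  (suc u + (suc v + pairTotal M)) ∷ (suc v + pairTotal M) ∷ pairsToDistinct M

distinctToPairs : List ℕ → Pairs
distinctToPairs (a ∷ b ∷ r) = (a ∸ suc b , b ∸ suc (headOr0 r)) ∷ distinctToPairs r
distinctToPairs _ = []

headOr0-pairsToDistinct : ∀ M → headOr0 (pairsToDistinct M) ≡ pairTotal M
headOr0-pairsToDistinct [] = refl
headOr0-pairsToDistinct (_ ∷ _) = refl

pairsToDistinct-below : ∀ b M → pairTotal M < b → Linked _>_ (b ∷ pairsToDistinct M)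
pairsToDistinct-below b [] _ = [-]
pairsToDistinct-below b ((u , v) ∷ M) t<b =
  t<b ∷ s≤s (m≤n+m _ u) ∷ pairsToDistinct-below _ M (s≤s (m≤n+m (pairTotal M) v))

pairsToDistinct-distinct : ∀ M → IsDistinctPartition (pairsToDistinct M)
pairsToDistinct-distinct M = strict M , positive M
  where
  strict : ∀ M → Linked _>_ (pairsToDistinct M)
  strict [] = []
  strict ((u , v) ∷ M) = s≤s (m≤n+m _ u) ∷ pairsToDistinct-below _ M (s≤s (m≤n+m (pairTotal M) v))
  positive : ∀ M → All (1 ≤_) (pairsToDistinct M)
  positive [] = []
  positive (_ ∷ M) = s≤s z≤n ∷ s≤s z≤n ∷ positive M

pairsToDistinct-even : ∀ M → HasEvenLength (pairsToDistinct M)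
pairsToDistinct-even M = length M , twice M
  where
  twice : ∀ M → length (pairsToDistinct M) ≡ 2 * length M
  twice [] = refl
  twice (_ ∷ M) = trans (cong (λ t → suc (suc t)) (twice M))
    (cong suc (sym (+-suc (length M) (length M + 0))))

pairTotal-sum : ∀ M → pairTotal M ≡ sum (firsts M) + sum (seconds M) + 2 * length M
pairTotal-sum [] = refl
pairTotal-sum ((u , v) ∷ M) rewrite pairTotal-sum M =
  regroup u v (sum (firsts M)) (sum (seconds M)) (length M)
  where
  regroup : ∀ u v a b l → suc u + (suc v + (a + b + 2 * l)) ≡ u + a + (v + b) + 2 * suc l
  regroup = solve-∀

-- The odd-indexed parts λ_{2i-1} = Σ_{j ≥ i} (uⱼ + vⱼ + 2) add up to the pair weight.
oddIndexedSum-pairsToDistinct : ∀ M → oddIndexedSum (pairsToDistinct M) ≡ pairWeight M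
oddIndexedSum-pairsToDistinct [] = refl
oddIndexedSum-pairsToDistinct ((u , v) ∷ M)
  rewrite oddIndexedSum-pairsToDistinct M | pairTotal-sum M =
  regroup u v (sum (firsts M)) (sum (seconds M))
    (weightedSum (firsts M)) (weightedSum (seconds M)) (length M)
  where
  regroup : ∀ u v a b wa wb l → suc u + (suc v + (a + b + 2 * l)) + (wa + wb + l * suc l)
            ≡ u + a + wa + (v + b + wb) + suc l * suc (suc l)
  regroup = solve-∀

distinctToPairs-pairsToDistinct : ∀ M → distinctToPairs (pairsToDistinct M) ≡ M
distinctToPairs-pairsToDistinct [] = refl
distinctToPairs-pairsToDistinct ((u , v) ∷ M)
  rewrite headOr0-pairsToDistinct M | distinctToPairs-pairsToDistinct M
        | m+n∸n≡m u (suc v + pairTotal M) | m+n∸n≡m v (pairTotal M) = refl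

gap-inverse : ∀ {a b} → b < a → suc (a ∸ suc b) + b ≡ a
gap-inverse {a} {b} b<a = trans (sym (+-suc (a ∸ suc b) b)) (m∸n+n≡m b<a)

headOr0-< : ∀ {b r} → Linked _>_ (b ∷ r) → 1 ≤ b → headOr0 r < b
headOr0-< {r = []} _ 1≤b = 1≤b
headOr0-< {r = _ ∷ _} (b>c ∷ _) _ = b>c

pairsToDistinct-distinctToPairs : ∀ l xs → IsDistinctPartition xs → length xs ≡ 2 * l →
                                  pairsToDistinct (distinctToPairs xs) ≡ xs
pairsToDistinct-distinctToPairs l [] _ _ = refl
pairsToDistinct-distinctToPairs zero (_ ∷ []) _ ()
pairsToDistinct-distinctToPairs (suc l) (_ ∷ []) _ e =
  ⊥-elim (0≢1+n (trans (suc-injective e) (+-suc l (l + 0))))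
pairsToDistinct-distinctToPairs zero (_ ∷ _ ∷ _) _ ()
pairsToDistinct-distinctToPairs (suc l) (a ∷ b ∷ r) (a>b ∷ d , _ ∷ pos-b ∷ pos-r) e =
  cong₂ _∷_ (trans (cong (λ t → suc (a ∸ suc b) + t) second) (gap-inverse a>b))
            (cong₂ _∷_ second rest)
  where
  rest : pairsToDistinct (distinctToPairs r) ≡ r
  rest = pairsToDistinct-distinctToPairs l r (Linked.tail d , pos-r)
    (suc-injective (trans (suc-injective e) (+-suc l (l + 0))))
  second : suc (b ∸ suc (headOr0 r)) + pairTotal (distinctToPairs r) ≡ b
  second = begin
    suc (b ∸ suc (headOr0 r)) + pairTotal (distinctToPairs r)
      ≡⟨ cong (suc (b ∸ suc (headOr0 r)) +_)
              (trans (sym (headOr0-pairsToDistinct (distinctToPairs r))) (cong headOr0 rest)) ⟩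
    suc (b ∸ suc (headOr0 r)) + headOr0 r
      ≡⟨ gap-inverse (headOr0-< d pos-b) ⟩
    b ∎
    where open ≡-Reasoning

DistinctCondition : ℕ → List ℕ → Set
DistinctCondition n xs = IsDistinctPartition xs × HasEvenLength xs × oddIndexedSum xs ≡ n

DistinctSide : ℕ → Set
DistinctSide n = Σ (List ℕ) (DistinctCondition n)

distinctCondition-irrelevant : ∀ {n} → IsPropValued (DistinctCondition n)
distinctCondition-irrelevant ((d , p) , (l , e) , s) ((d′ , p′) , (l′ , e′) , s′) =
  cong₂ _,_ (cong₂ _,_ (Linked.irrelevant <-irrelevant d d′) (All.irrelevant ≤-irrelevant p p′))
    (cong₂ _,_ (Σ-≡ ≡-irrelevant (*-cancelˡ-≡ l l′ 2 (trans (sym e) e′)) e e′) (≡-irrelevant s s′))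

distinct↔pairs : ∀ n → DistinctSide n ↔ PairsOfWeight n
distinct↔pairs n =
  subset-↔ distinctCondition-irrelevant ≡-irrelevant distinctToPairs pairsToDistinct
  (λ {xs} (dp , (l , e) , s) → trans (sym (oddIndexedSum-pairsToDistinct (distinctToPairs xs)))
     (trans (cong oddIndexedSum (pairsToDistinct-distinctToPairs l xs dp e)) s))
  (λ {M} w → pairsToDistinct-distinct M , pairsToDistinct-even M ,
             trans (oddIndexedSum-pairsToDistinct M) w)
  (λ {xs} (dp , (l , e) , _) → pairsToDistinct-distinctToPairs l xs dp e)
  (λ {M} _ → distinctToPairs-pairsToDistinct M)

-- suffixSums (g₁ ∷ ⋯ ∷ g_l) = (g₁+⋯+g_l) ∷ (g₂+⋯+g_l) ∷ ⋯ ∷ (g_l): a list of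
-- naturals is the list of consecutive differences of exactly one decreasing list.
suffixSums : List ℕ → List ℕ
suffixSums [] = []
suffixSums (g ∷ gs) = (g + headOr0 (suffixSums gs)) ∷ suffixSums gs

differences : List ℕ → List ℕ
differences [] = []
differences (x ∷ xs) = (x ∸ headOr0 xs) ∷ differences xs

headOr0-suffixSums : ∀ gs → headOr0 (suffixSums gs) ≡ sum gs
headOr0-suffixSums [] = refl
headOr0-suffixSums (g ∷ gs) = cong (g +_) (headOr0-suffixSums gs)

sum-suffixSums : ∀ gs → sum (suffixSums gs) ≡ weightedSum gs
sum-suffixSums [] = refl
sum-suffixSums (g ∷ gs) rewrite sum-suffixSums gs | headOr0-suffixSums gs = refl

length-suffixSums : ∀ gs → length (suffixSums gs) ≡ length gs
length-suffixSums [] = refl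
length-suffixSums (_ ∷ gs) = cong suc (length-suffixSums gs)

length-differences : ∀ xs → length (differences xs) ≡ length xs
length-differences [] = refl
length-differences (_ ∷ xs) = cong suc (length-differences xs)

suffixSums-decreasing : ∀ gs → Decreasing (suffixSums gs)
suffixSums-decreasing [] = []
suffixSums-decreasing (g ∷ gs) = below gs (m≤n+m _ g)
  where
  below : ∀ gs {x} → headOr0 (suffixSums gs) ≤ x → Decreasing (x ∷ suffixSums gs)
  below [] _ = [-]
  below (g ∷ gs) h = h ∷ below gs (m≤n+m _ g)

differences-suffixSums : ∀ gs → differences (suffixSums gs) ≡ gs
differences-suffixSums [] = refl
differences-suffixSums (g ∷ gs) =
  cong₂ _∷_ (m+n∸n≡m g (headOr0 (suffixSums gs))) (differences-suffixSums gs)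

suffixSums-differences : ∀ xs → Decreasing xs → suffixSums (differences xs) ≡ xs
suffixSums-differences [] _ = refl
suffixSums-differences (x ∷ xs) d = cong₂ _∷_ headEq rest
  where
  rest : suffixSums (differences xs) ≡ xs
  rest = suffixSums-differences xs (Linked.tail d)
  headEq : x ∸ headOr0 xs + headOr0 (suffixSums (differences xs)) ≡ x
  headEq rewrite rest = m∸n+n≡m (headOr0-≤ d)

isOne? : (x : ℕ) → Dec (x ≡ 1)
isOne? x = x ≟ 1

ω-++ : ∀ xs ys → ω (xs ++ ys) ≡ ω xs + ω ys
ω-++ xs ys rewrite filter-++ isOne? xs ys = length-++ (filter isOne? xs)

ω-none : ∀ {xs} → All (2 ≤_) xs → ω xs ≡ 0
ω-none 2≤xs = cong length (filter-none isOne? (All.map (λ { (s≤s ()) refl }) 2≤xs))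

ω-replicate : ∀ c → ω (replicate c 1) ≡ c
ω-replicate c = trans (cong length (filter-all isOne? (AllP.replicate⁺ c refl))) (length-replicate c)

all-ones : ∀ {xs} → All (1 ≤_) xs → All (_≤ 1) xs → xs ≡ replicate (ω xs) 1
all-ones {[]} _ _ = refl
all-ones {x ∷ xs} (1≤x ∷ ps) (x≤1 ∷ qs) with ≤-antisym x≤1 1≤x
... | refl = cong (1 ∷_) (all-ones ps qs)

-- fromMultiplicities (c₁ ∷ ⋯ ∷ c_K) is the partition with exactly c_k parts equal to k;
-- multiplicities K σ reads these counts back from a partition σ with parts ≤ K.
fromMultiplicities : List ℕ → List ℕ
fromMultiplicities [] = []
fromMultiplicities (c ∷ cs) = map suc (fromMultiplicities cs) ++ replicate c 1

atLeastTwo? : (x : ℕ) → Dec (2 ≤ x)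
atLeastTwo? x = 2 ≤? x

multiplicities : ℕ → List ℕ → List ℕ
multiplicities zero _ = []
multiplicities (suc K) σ = ω σ ∷ multiplicities K (map pred (filter atLeastTwo? σ))

length-multiplicities : ∀ K σ → length (multiplicities K σ) ≡ K
length-multiplicities zero _ = refl
length-multiplicities (suc K) _ = cong suc (length-multiplicities K _)

length-fromMultiplicities : ∀ cs → length (fromMultiplicities cs) ≡ sum cs
length-fromMultiplicities [] = refl
length-fromMultiplicities (c ∷ cs)
  rewrite length-++ (map suc (fromMultiplicities cs)) {replicate c 1}
        | length-map suc (fromMultiplicities cs) | length-fromMultiplicities cs
        | length-replicate c {1} = +-comm (sum cs) c

fromMultiplicities-positive : ∀ cs → All (1 ≤_) (fromMultiplicities cs)
fromMultiplicities-positive [] = []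
fromMultiplicities-positive (c ∷ cs) =
  AllP.++⁺ (AllP.map⁺ (All.map (λ _ → s≤s z≤n) (fromMultiplicities-positive cs)))
           (AllP.replicate⁺ c ≤-refl)

fromMultiplicities-shifted : ∀ cs → All (2 ≤_) (map suc (fromMultiplicities cs))
fromMultiplicities-shifted cs = AllP.map⁺ (All.map s≤s (fromMultiplicities-positive cs))

fromMultiplicities-bounded : ∀ cs → All (_≤ length cs) (fromMultiplicities cs)
fromMultiplicities-bounded [] = []
fromMultiplicities-bounded (c ∷ cs) =
  AllP.++⁺ (AllP.map⁺ (All.map s≤s (fromMultiplicities-bounded cs))) (AllP.replicate⁺ c (s≤s z≤n))

fromMultiplicities-decreasing : ∀ cs → Decreasing (fromMultiplicities cs)
fromMultiplicities-decreasing [] = []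
fromMultiplicities-decreasing (c ∷ cs) =
  ++-decreasing {b = 1} (map-decreasing s≤s (fromMultiplicities-decreasing cs))
    (replicate-decreasing c 1) (All.map (≤-trans (s≤s z≤n)) (fromMultiplicities-shifted cs))
    (AllP.replicate⁺ c ≤-refl)

sum-fromMultiplicities : ∀ cs → sum (fromMultiplicities cs) ≡ weightedSum cs
sum-fromMultiplicities [] = refl
sum-fromMultiplicities (c ∷ cs) = begin
  sum (map suc σ ++ replicate c 1)
    ≡⟨ sum-++ (map suc σ) (replicate c 1) ⟩
  sum (map suc σ) + sum (replicate c 1)
    ≡⟨ cong₂ _+_ (sum-map-+ 1 σ) (sum-replicate c 1) ⟩
  length σ * 1 + sum σ + c * 1
    ≡⟨ cong₂ (λ l s → l * 1 + s + c * 1) (length-fromMultiplicities cs) (sum-fromMultiplicities cs) ⟩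
  sum cs * 1 + weightedSum cs + c * 1
    ≡⟨ regroup c (sum cs) (weightedSum cs) ⟩
  c + sum cs + weightedSum cs ∎
  where
  open ≡-Reasoning
  σ = fromMultiplicities cs
  regroup : ∀ c s w → s * 1 + w + c * 1 ≡ c + s + w
  regroup = solve-∀

ω-fromMultiplicities : ∀ c cs → ω (fromMultiplicities (c ∷ cs)) ≡ c
ω-fromMultiplicities c cs
  rewrite ω-++ (map suc (fromMultiplicities cs)) (replicate c 1)
        | ω-none (fromMultiplicities-shifted cs) = ω-replicate c

lower-fromMultiplicities : ∀ c cs →
  map pred (filter atLeastTwo? (fromMultiplicities (c ∷ cs))) ≡ fromMultiplicities cs
lower-fromMultiplicities c cs = begin
  map pred (filter atLeastTwo? (map suc σ ++ replicate c 1))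
    ≡⟨ cong (map pred) (filter-++ atLeastTwo? (map suc σ) (replicate c 1)) ⟩
  map pred (filter atLeastTwo? (map suc σ) ++ filter atLeastTwo? (replicate c 1))
    ≡⟨ cong₂ (λ xs ys → map pred (xs ++ ys)) (filter-all atLeastTwo? (fromMultiplicities-shifted cs))
         (filter-none atLeastTwo? (AllP.replicate⁺ c λ { (s≤s ()) })) ⟩
  map pred (map suc σ ++ [])
    ≡⟨ cong (map pred) (++-identityʳ (map suc σ)) ⟩
  map pred (map suc σ)
    ≡⟨ sym (map-∘ σ) ⟩
  map (λ x → x) σ
    ≡⟨ map-id σ ⟩
  σ ∎
  where
  open ≡-Reasoning
  σ = fromMultiplicities cs

multiplicities-fromMultiplicities : ∀ cs → multiplicities (length cs) (fromMultiplicities cs) ≡ cs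
multiplicities-fromMultiplicities [] = refl
multiplicities-fromMultiplicities (c ∷ cs) =
  cong₂ _∷_ (ω-fromMultiplicities c cs)
    (trans (cong (multiplicities (length cs)) (lower-fromMultiplicities c cs))
           (multiplicities-fromMultiplicities cs))

separate-ones : ∀ σ → Decreasing σ → All (1 ≤_) σ → σ ≡ filter atLeastTwo? σ ++ replicate (ω σ) 1
separate-ones [] _ _ = refl
separate-ones (x ∷ xs) d (1≤x ∷ ps) with 2 ≤? x
... | yes 2≤x = begin
  x ∷ xs
    ≡⟨ cong (x ∷_) (separate-ones xs (Linked.tail d) ps) ⟩
  x ∷ filter atLeastTwo? xs ++ replicate (ω xs) 1
    ≡⟨ cong (λ t → x ∷ filter atLeastTwo? xs ++ replicate t 1) (sym onesUnchanged) ⟩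
  (x ∷ filter atLeastTwo? xs) ++ replicate (ω (x ∷ xs)) 1
    ≡⟨ cong (_++ replicate (ω (x ∷ xs)) 1) (sym (filter-accept atLeastTwo? 2≤x)) ⟩
  filter atLeastTwo? (x ∷ xs) ++ replicate (ω (x ∷ xs)) 1 ∎
  where
  open ≡-Reasoning
  onesUnchanged : ω (x ∷ xs) ≡ ω xs
  onesUnchanged = cong length (filter-reject isOne? {xs = xs} (λ x≡1 → <-irrefl (sym x≡1) 2≤x))
... | no 2≰x with ≤-antisym (≤-pred (≰⇒> 2≰x)) 1≤x
...   | refl = trans (all-ones (1≤x ∷ ps) atMostOne)
                 (sym (cong (_++ replicate (ω (1 ∷ xs)) 1)
                        (filter-none atLeastTwo? (All.map (λ x≤1 2≤x → ≤⇒≯ 2≤x (s≤s x≤1)) atMostOne))))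
  where
  atMostOne : All (_≤ 1) (1 ∷ xs)
  atMostOne = decreasing⇒bounded d ≤-refl

fromMultiplicities-multiplicities : ∀ K σ → Decreasing σ → All (1 ≤_) σ → All (_≤ K) σ →
                                    fromMultiplicities (multiplicities K σ) ≡ σ
fromMultiplicities-multiplicities zero [] _ _ _ = refl
fromMultiplicities-multiplicities zero (x ∷ σ) _ (1≤x ∷ _) (x≤0 ∷ _) = ⊥-elim (<⇒≱ 1≤x x≤0)
fromMultiplicities-multiplicities (suc K) σ d pos bd =
  trans (cong (_++ replicate (ω σ) 1) (trans (cong (map suc) lowered) raise))
        (sym (separate-ones σ d pos))
  where
  big = filter atLeastTwo? σ
  2≤big : All (2 ≤_) big
  2≤big = AllP.all-filter atLeastTwo? σ
  lowered : fromMultiplicities (multiplicities K (map pred big)) ≡ map pred big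
  lowered = fromMultiplicities-multiplicities K (map pred big)
    (map-decreasing pred-mono-≤ (decreasing-++ˡ big (subst Decreasing (separate-ones σ d pos) d)))
    (AllP.map⁺ (All.map (λ { (s≤s (s≤s z≤n)) → s≤s z≤n }) 2≤big))
    (AllP.map⁺ (All.map pred-mono-≤ (AllP.filter⁺ atLeastTwo? bd)))
  raise : map suc (map pred big) ≡ big
  raise = trans (sym (map-∘ big)) (map-id-local (All.map (λ { (s≤s (s≤s z≤n)) → refl }) 2≤big))

quotient-remainder : ∀ {r n} q .{{_ : NonZero n}} → r < n →
                     (r + q * n) / n ≡ q × (r + q * n) % n ≡ r
quotient-remainder {r} {n} q r<n =
  trans (+-distrib-/-∣ʳ r (n∣m*n q)) (cong₂ _+_ (m<n⇒m/n≡0 r<n) (m*n/n≡m q n)) ,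
  trans ([m+kn]%n≡m%n r q n) (m<n⇒m%n≡m r<n)

-- The small part of a crank-side partition with l rows: parts ≤ l+1, at most l ones.
-- It is encoded by (v₁, …, v_l) with v₁ = m₁ + (l+1)·m_{l+1} and vₖ = mₖ for 2 ≤ k ≤ l,
-- where mₖ is the multiplicity of k; since m₁ ≤ l, division by l+1 recovers m₁ and m_{l+1}.
smallPart : ℕ → List ℕ → List ℕ
smallPart l [] = []
smallPart l (d ∷ t) = replicate (d / suc l) (suc l) ++ fromMultiplicities ((d % suc l) ∷ t)

smallPart-lower-bounded : ∀ l r t → length t < l → All (_≤ l) (fromMultiplicities (r ∷ t))
smallPart-lower-bounded l r t t<l = All.map (λ p → ≤-trans p t<l) (fromMultiplicities-bounded (r ∷ t))

smallPart-bounded : ∀ l ds → length ds ≡ l → All (_≤ suc l) (smallPart l ds)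
smallPart-bounded l [] _ = []
smallPart-bounded l (d ∷ t) refl =
  AllP.++⁺ (AllP.replicate⁺ (d / suc l) ≤-refl)
           (All.map m≤n⇒m≤1+n (smallPart-lower-bounded l (d % suc l) t ≤-refl))

smallPart-decreasing : ∀ l ds → length ds ≡ l → Decreasing (smallPart l ds)
smallPart-decreasing l [] _ = []
smallPart-decreasing l (d ∷ t) refl =
  ++-decreasing {b = suc l} (replicate-decreasing (d / suc l) (suc l))
    (fromMultiplicities-decreasing ((d % suc l) ∷ t)) (AllP.replicate⁺ (d / suc l) ≤-refl)
    (All.map m≤n⇒m≤1+n (smallPart-lower-bounded l (d % suc l) t ≤-refl))

smallPart-positive : ∀ l ds → All (1 ≤_) (smallPart l ds)
smallPart-positive l [] = []
smallPart-positive l (d ∷ t) =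
  AllP.++⁺ (AllP.replicate⁺ (d / suc l) (s≤s z≤n)) (fromMultiplicities-positive ((d % suc l) ∷ t))

sum-smallPart : ∀ l ds → sum (smallPart l ds) ≡ weightedSum ds
sum-smallPart l [] = refl
sum-smallPart l (d ∷ t) = begin
  sum (replicate q (suc l) ++ fromMultiplicities (r ∷ t))
    ≡⟨ sum-++ (replicate q (suc l)) (fromMultiplicities (r ∷ t)) ⟩
  sum (replicate q (suc l)) + sum (fromMultiplicities (r ∷ t))
    ≡⟨ cong₂ _+_ (sum-replicate q (suc l)) (sum-fromMultiplicities (r ∷ t)) ⟩
  q * suc l + (r + sum t + weightedSum t)
    ≡⟨ regroup (q * suc l) r (sum t) (weightedSum t) ⟩
  r + q * suc l + sum t + weightedSum t
    ≡⟨ cong (λ d′ → d′ + sum t + weightedSum t) (sym (m≡m%n+[m/n]*n d (suc l))) ⟩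
  d + sum t + weightedSum t ∎
  where
  open ≡-Reasoning
  q = d / suc l
  r = d % suc l
  regroup : ∀ a b s w → a + (b + s + w) ≡ b + a + s + w
  regroup = solve-∀

ω-replicate-++ : ∀ q k ys → ω (replicate q (suc (suc k)) ++ ys) ≡ ω ys
ω-replicate-++ q k ys = trans (ω-++ (replicate q (suc (suc k))) ys)
  (cong (_+ ω ys) (ω-none (AllP.replicate⁺ q (s≤s (s≤s z≤n)))))

-- The ones of smallPart l ds are the remainder of v₁ modulo l+1, hence at most l.
ω-smallPart : ∀ l ds → length ds ≡ l → ω (smallPart l ds) ≤ l
ω-smallPart l [] _ = z≤n
ω-smallPart (suc l) (d ∷ t) _
  rewrite ω-replicate-++ (d / suc (suc l)) l (fromMultiplicities ((d % suc (suc l)) ∷ t))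
        | ω-fromMultiplicities (d % suc (suc l)) t = ≤-pred (m%n<n d (suc (suc l)))

peelCopies : ℕ → List ℕ → ℕ × List ℕ
peelCopies K [] = 0 , []
peelCopies K (x ∷ xs) with x ≟ K
... | yes _ = suc (proj₁ (peelCopies K xs)) , proj₂ (peelCopies K xs)
... | no _ = 0 , x ∷ xs

peelCopies-++ : ∀ K σ → replicate (proj₁ (peelCopies K σ)) K ++ proj₂ (peelCopies K σ) ≡ σ
peelCopies-++ K [] = refl
peelCopies-++ K (x ∷ xs) with x ≟ K
... | yes refl = cong (x ∷_) (peelCopies-++ K xs)
... | no _ = refl

peelCopies-rest : ∀ K σ → Decreasing σ → All (_≤ K) σ → All (_< K) (proj₂ (peelCopies K σ))
peelCopies-rest K [] _ _ = []
peelCopies-rest K (x ∷ xs) d (x≤K ∷ bd) with x ≟ K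
... | yes _ = peelCopies-rest K xs (Linked.tail d) bd
... | no x≢K = All.map (λ y≤x → ≤-<-trans y≤x (≤∧≢⇒< x≤K x≢K)) (decreasing⇒bounded d ≤-refl)

peelCopies-replicate : ∀ K q ys → All (_< K) ys → peelCopies K (replicate q K ++ ys) ≡ (q , ys)
peelCopies-replicate K zero [] _ = refl
peelCopies-replicate K zero (y ∷ ys) (y<K ∷ _) with y ≟ K
... | yes y≡K = ⊥-elim (<-irrefl y≡K y<K)
... | no _ = refl
peelCopies-replicate K (suc q) ys small with K ≟ K
... | yes _ rewrite peelCopies-replicate K q ys small = refl
... | no K≢K = ⊥-elim (K≢K refl)

addToHead : ℕ → List ℕ → List ℕ
addToHead k [] = []
addToHead k (r ∷ t) = (r + k) ∷ t

smallPartCode : ℕ → List ℕ → List ℕ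
smallPartCode l σ =
  addToHead (proj₁ (peelCopies (suc l) σ) * suc l) (multiplicities l (proj₂ (peelCopies (suc l) σ)))

length-smallPartCode : ∀ l σ → length (smallPartCode l σ) ≡ l
length-smallPartCode l σ = trans (length-addToHead (multiplicities l _)) (length-multiplicities l _)
  where
  length-addToHead : ∀ {k} xs → length (addToHead k xs) ≡ length xs
  length-addToHead [] = refl
  length-addToHead (_ ∷ _) = refl

smallPartCode-smallPart : ∀ ds → smallPartCode (length ds) (smallPart (length ds) ds) ≡ ds
smallPartCode-smallPart [] = refl
smallPartCode-smallPart (d ∷ t) = begin
  smallPartCode l (replicate q (suc l) ++ fromMultiplicities (r ∷ t))
    ≡⟨ cong (λ p → addToHead (proj₁ p * suc l) (multiplicities l (proj₂ p)))
            (peelCopies-replicate (suc l) q (fromMultiplicities (r ∷ t))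
              (All.map s≤s (fromMultiplicities-bounded (r ∷ t)))) ⟩
  addToHead (q * suc l) (multiplicities l (fromMultiplicities (r ∷ t)))
    ≡⟨ cong (addToHead (q * suc l)) (multiplicities-fromMultiplicities (r ∷ t)) ⟩
  (r + q * suc l) ∷ t
    ≡⟨ cong (_∷ t) (sym (m≡m%n+[m/n]*n d (suc l))) ⟩
  d ∷ t ∎
  where
  open ≡-Reasoning
  l = suc (length t)
  q = d / suc l
  r = d % suc l

smallPart-addToHead : ∀ l q rest → Decreasing rest → All (1 ≤_) rest →
  All (_≤ suc l) rest → ω rest ≤ suc l →
  smallPart (suc l) (addToHead (q * suc (suc l)) (multiplicities (suc l) rest))
    ≡ replicate q (suc (suc l)) ++ rest
smallPart-addToHead l q rest d pos bd ω≤l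
  with quotient-remainder {ω rest} {suc (suc l)} q (s≤s ω≤l)
... | quotient , remainder = begin
  replicate ((ω rest + q * n) / n) n ++ fromMultiplicities (((ω rest + q * n) % n) ∷ t)
    ≡⟨ cong₂ (λ a c → replicate a n ++ fromMultiplicities (c ∷ t)) quotient remainder ⟩
  replicate q n ++ fromMultiplicities (multiplicities (suc l) rest)
    ≡⟨ cong (replicate q n ++_) (fromMultiplicities-multiplicities (suc l) rest d pos bd) ⟩
  replicate q n ++ rest ∎
  where
  open ≡-Reasoning
  n = suc (suc l)
  t = multiplicities l (map pred (filter atLeastTwo? rest))

smallPart-smallPartCode : ∀ l σ → Decreasing σ → All (1 ≤_) σ → All (_≤ suc l) σ → ω σ ≤ l →
                          smallPart l (smallPartCode l σ) ≡ σ
smallPart-smallPartCode zero σ _ pos bd ω≤0 =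
  sym (trans (all-ones pos bd) (cong (λ t → replicate t 1) (n≤0⇒n≡0 ω≤0)))
smallPart-smallPartCode (suc l) σ d pos bd ω≤l =
  trans (smallPart-addToHead l q rest
           (decreasing-++ʳ (replicate q n) (subst Decreasing (sym split) d))
           (AllP.++⁻ʳ (replicate q n) (subst (All (1 ≤_)) (sym split) pos))
           (All.map ≤-pred (peelCopies-rest n σ d bd))
           (subst (_≤ suc l) (trans (cong ω (sym split)) (ω-replicate-++ q l rest)) ω≤l))
        split
  where
  n = suc (suc l)
  q = proj₁ (peelCopies n σ)
  rest = proj₂ (peelCopies n σ)
  split : replicate q n ++ rest ≡ σ
  split = peelCopies-++ n σ

crankCases : ℕ → List ℕ → ℤ
crankCases zero xs = ℤ.+ largestPart xs
crankCases (suc _) xs = ℤ.+ μ xs ℤ.- ℤ.+ ω xs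

crank-cases : ∀ xs → crank xs ≡ crankCases (ω xs) xs
crank-cases xs with ω xs
... | zero = refl
... | suc _ = refl

crank-nonneg : ∀ xs → ω xs ≤ μ xs → ℤ.+ 0 ℤ.≤ crank xs
crank-nonneg xs ω≤μ = subst (ℤ.+ 0 ℤ.≤_) (sym (crank-cases xs)) (cases (ω xs))
  where
  cases : ∀ k → ℤ.+ 0 ℤ.≤ crankCases k xs
  cases zero = ℤ.+≤+ z≤n
  cases (suc _) = ℤP.i≤j⇒0≤j-i (ℤ.+≤+ ω≤μ)

crank-nonneg⁻ : ∀ xs → ℤ.+ 0 ℤ.≤ crank xs → ω xs ≡ 0 ⊎ ω xs ≤ μ xs
crank-nonneg⁻ xs 0≤crank = cases (ω xs) refl (subst (ℤ.+ 0 ℤ.≤_) (crank-cases xs) 0≤crank)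
  where
  cases : ∀ k → ω xs ≡ k → ℤ.+ 0 ℤ.≤ crankCases k xs → ω xs ≡ 0 ⊎ ω xs ≤ μ xs
  cases zero ω≡0 _ = inj₁ ω≡0
  cases (suc _) _ 0≤μ-ω = inj₂ (ℤP.drop‿+≤+ (ℤP.0≤i-j⇒j≤i 0≤μ-ω))

-- splitRows k π takes parts from the front of π while the i-th of them exceeds k+i-1.
-- For k = 1 these rows are the parts πᵢ ≥ i+1; the remaining parts form the small part.
splitRows : ℕ → List ℕ → List ℕ × List ℕ
splitRows k [] = [] , []
splitRows k (x ∷ xs) with k <? x
... | yes _ = x ∷ proj₁ (splitRows (suc k) xs) , proj₂ (splitRows (suc k) xs)
... | no _ = [] , x ∷ xs

splitRows-++ : ∀ k xs → proj₁ (splitRows k xs) ++ proj₂ (splitRows k xs) ≡ xs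
splitRows-++ k [] = refl
splitRows-++ k (x ∷ xs) with k <? x
... | yes _ = cong (x ∷_) (splitRows-++ (suc k) xs)
... | no _ = refl

splitRows-exact : ∀ k rows σ → All (k + length rows ≤_) rows → All (_≤ k + length rows) σ →
                  splitRows k (rows ++ σ) ≡ (rows , σ)
splitRows-exact k [] [] _ _ = refl
splitRows-exact k [] (y ∷ ys) _ (y≤k+0 ∷ _) with k <? y
... | yes k<y = ⊥-elim (<⇒≱ k<y (subst (y ≤_) (+-identityʳ k) y≤k+0))
... | no _ = refl
splitRows-exact k (x ∷ rows) σ (k+l≤x ∷ big) small with k <? x
... | no k≮x = ⊥-elim (k≮x (≤-trans (subst (_≤ k + suc (length rows)) (+-comm k 1)
                                        (+-monoʳ-≤ k (s≤s z≤n))) k+l≤x))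
... | yes _ rewrite splitRows-exact (suc k) rows σ
                      (All.map (≤-trans (≤-reflexive (sym (+-suc k (length rows))))) big)
                      (All.map (λ p → ≤-trans p (≤-reflexive (+-suc k (length rows)))) small) = refl

splitRows-bounds : ∀ k xs → Decreasing xs →
  let (rows , σ) = splitRows k xs in All (k + length rows ≤_) rows × All (_≤ k + length rows) σ
splitRows-bounds k [] _ = [] , []
splitRows-bounds k (x ∷ xs) d with k <? x
... | no k≮x = [] , decreasing⇒bounded d (subst (x ≤_) (sym (+-identityʳ k)) (≤-pred (≰⇒> k≮x)))
... | yes k<x = (k+l≤x ∷ All.map (≤-trans (≤-reflexive (+-suc k l))) (proj₁ later))
              , All.map (λ p → ≤-trans p (≤-reflexive (sym (+-suc k l)))) (proj₂ later)
  where
  later = splitRows-bounds (suc k) xs (Linked.tail d)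
  l = length (proj₁ (splitRows (suc k) xs))
  rows≤x : All (_≤ x) (proj₁ (splitRows (suc k) xs))
  rows≤x = AllP.++⁻ˡ (proj₁ (splitRows (suc k) xs))
    (subst (All (_≤ x)) (sym (splitRows-++ (suc k) xs)) (All.tail (decreasing⇒bounded d ≤-refl)))
  k+l≤x : k + suc l ≤ x
  k+l≤x with proj₁ (splitRows (suc k) xs) | proj₁ later | rows≤x
  ... | [] | _ | _ = subst (_≤ x) (+-comm 1 k) k<x
  ... | y ∷ r | k+l≤y ∷ _ | y≤x ∷ _ =
    subst (_≤ x) (sym (+-suc k (suc (length r)))) (≤-trans k+l≤y y≤x)

ω-rows : ∀ l rows → length rows ≡ l → All (suc l ≤_) rows → ω rows ≡ 0
ω-rows l [] _ _ = refl
ω-rows (suc l) (_ ∷ _) _ big = ω-none (All.map (≤-trans (s≤s (s≤s z≤n))) big)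

module RowsAboveSmallPart (l : ℕ) (rows σ : List ℕ) (length-rows : length rows ≡ l)
                          (big : All (suc l ≤_) rows) (small : All (_≤ suc l) σ) where

  π : List ℕ
  π = rows ++ σ

  ω-π : ω π ≡ ω σ
  ω-π = trans (ω-++ rows σ) (cong (_+ ω σ) (ω-rows l rows length-rows big))

  exceedsOnes? : (x : ℕ) → Dec (ω π < x)
  exceedsOnes? x = ω π <? x

  -- With at most l ones, every row exceeds ω, so μ ≥ l ≥ ω.
  crank-nonneg-if-few-ones : ω σ ≤ l → ℤ.+ 0 ℤ.≤ crank π
  crank-nonneg-if-few-ones ω≤l = crank-nonneg π (≤-trans ω-π≤l l≤μ)
    where
    ω-π≤l : ω π ≤ l
    ω-π≤l = subst (_≤ l) (sym ω-π) ω≤l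
    l≤μ : l ≤ μ π
    l≤μ = begin
      l ≡⟨ sym length-rows ⟩
      length rows ≡⟨ cong length (sym (filter-all exceedsOnes? (All.map (<-≤-trans (s≤s ω-π≤l)) big))) ⟩
      length (filter exceedsOnes? rows) ≤⟨ m≤m+n _ _ ⟩
      length (filter exceedsOnes? rows) + length (filter exceedsOnes? σ)
        ≡⟨ sym (length-++ (filter exceedsOnes? rows)) ⟩
      length (filter exceedsOnes? rows ++ filter exceedsOnes? σ)
        ≡⟨ cong length (sym (filter-++ exceedsOnes? rows σ)) ⟩
      μ π ∎
      where open ≤-Reasoning

  -- With more than l ones, no part of σ exceeds ω, so μ ≤ l < ω.
  few-ones-if-crank-nonneg : ℤ.+ 0 ℤ.≤ crank π → ω σ ≤ l
  few-ones-if-crank-nonneg 0≤crank with ω σ ≤? l | crank-nonneg⁻ π 0≤crank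
  ... | yes ω≤l | _ = ω≤l
  ... | no ω≰l | inj₁ ω≡0 = ⊥-elim (ω≰l (subst (_≤ l) (trans (sym ω≡0) ω-π) z≤n))
  ... | no ω≰l | inj₂ ω≤μ = ⊥-elim (<⇒≱ l<ω (≤-trans (subst (_≤ μ π) ω-π ω≤μ) μ≤l))
    where
    l<ω : l < ω σ
    l<ω = ≰⇒> ω≰l
    μ≤l : μ π ≤ l
    μ≤l = begin
      μ π ≡⟨ cong length (filter-++ exceedsOnes? rows σ) ⟩
      length (filter exceedsOnes? rows ++ filter exceedsOnes? σ)
        ≡⟨ cong (λ ys → length (filter exceedsOnes? rows ++ ys))
                (filter-none exceedsOnes? (All.map (λ x≤l+1 ω<x → <⇒≱ ω<x
                   (≤-trans x≤l+1 (subst (suc l ≤_) (sym ω-π) l<ω))) small)) ⟩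
      length (filter exceedsOnes? rows ++ []) ≡⟨ cong length (++-identityʳ (filter exceedsOnes? rows)) ⟩
      length (filter exceedsOnes? rows) ≤⟨ length-filter exceedsOnes? rows ⟩
      length rows ≡⟨ length-rows ⟩
      l ∎
      where open ≤-Reasoning

rowsOf : ℕ → List ℕ → List ℕ
rowsOf l us = map (suc l +_) (suffixSums us)

length-rowsOf : ∀ l us → length (rowsOf l us) ≡ length us
length-rowsOf l us = trans (length-map _ (suffixSums us)) (length-suffixSums us)

rowsOf-big : ∀ l us → All (suc l ≤_) (rowsOf l us)
rowsOf-big l us = AllP.map⁺ (All.universal (m≤m+n (suc l)) (suffixSums us))

rowsOf-differences : ∀ l rows → Decreasing rows → All (suc l ≤_) rows →
                     rowsOf l (differences (map (_∸ suc l) rows)) ≡ rows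
rowsOf-differences l rows d big = begin
  map (suc l +_) (suffixSums (differences (map (_∸ suc l) rows)))
    ≡⟨ cong (map (suc l +_)) (suffixSums-differences _ (map-decreasing (∸-monoˡ-≤ (suc l)) d)) ⟩
  map (suc l +_) (map (_∸ suc l) rows)
    ≡⟨ sym (map-∘ rows) ⟩
  map (λ x → suc l + (x ∸ suc l)) rows
    ≡⟨ map-id-local (All.map m+[n∸m]≡n big) ⟩
  rows ∎
  where open ≡-Reasoning

assemble : ℕ → List ℕ → List ℕ → List ℕ
assemble l us vs = rowsOf l us ++ smallPart l vs

assemble-partition : ∀ l us vs → length vs ≡ l → IsPartition (assemble l us vs)
assemble-partition l us vs refl =
  ++-decreasing {b = suc l} (map-decreasing (+-monoʳ-≤ (suc l)) (suffixSums-decreasing us))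
    (smallPart-decreasing l vs refl) (rowsOf-big l us) (smallPart-bounded l vs refl) ,
  AllP.++⁺ (All.map (≤-trans (s≤s z≤n)) (rowsOf-big l us)) (smallPart-positive l vs)

assemble-sum : ∀ l us vs → length us ≡ l →
               sum (assemble l us vs) ≡ weightedSum us + weightedSum vs + l * suc l
assemble-sum l us vs refl = begin
  sum (rowsOf l us ++ smallPart l vs)
    ≡⟨ sum-++ (rowsOf l us) (smallPart l vs) ⟩
  sum (map (suc l +_) (suffixSums us)) + sum (smallPart l vs)
    ≡⟨ cong₂ _+_ (sum-map-+ (suc l) (suffixSums us)) (sum-smallPart l vs) ⟩
  length (suffixSums us) * suc l + sum (suffixSums us) + weightedSum vs
    ≡⟨ cong₂ (λ a b → a * suc l + b + weightedSum vs) (length-suffixSums us) (sum-suffixSums us) ⟩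
  l * suc l + weightedSum us + weightedSum vs
    ≡⟨ regroup (l * suc l) (weightedSum us) (weightedSum vs) ⟩
  weightedSum us + weightedSum vs + l * suc l ∎
  where
  open ≡-Reasoning
  regroup : ∀ a b c → a + b + c ≡ b + c + a
  regroup = solve-∀

assemble-crank : ∀ l us vs → length us ≡ l → length vs ≡ l → ℤ.+ 0 ℤ.≤ crank (assemble l us vs)
assemble-crank l us vs refl length-vs =
  RowsAboveSmallPart.crank-nonneg-if-few-ones l (rowsOf l us) (smallPart l vs)
    (length-rowsOf l us) (rowsOf-big l us) (smallPart-bounded l vs length-vs)
    (ω-smallPart l vs length-vs)

pairsToCrank : Pairs → List ℕ
pairsToCrank M = assemble (length M) (firsts M) (seconds M)

disassemble : ℕ → List ℕ → List ℕ → Pairs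
disassemble l rows σ = zip (differences (map (_∸ suc l) rows)) (smallPartCode l σ)

crankToPairs : List ℕ → Pairs
crankToPairs π =
  disassemble (length (proj₁ (splitRows 1 π))) (proj₁ (splitRows 1 π)) (proj₂ (splitRows 1 π))

zip-components : ∀ xs ys → length xs ≡ length ys →
                 length (zip xs ys) ≡ length xs × firsts (zip xs ys) ≡ xs × seconds (zip xs ys) ≡ ys
zip-components xs ys same =
  trans (sym (length-firsts (zip xs ys))) (cong length firsts≡) , firsts≡ , cong proj₂ (unzip-zip xs ys same)
  where
  firsts≡ : firsts (zip xs ys) ≡ xs
  firsts≡ = cong proj₁ (unzip-zip xs ys same)

crankToPairs-pairsToCrank : ∀ M → crankToPairs (pairsToCrank M) ≡ M
crankToPairs-pairsToCrank M = begin
  crankToPairs (rows ++ σ)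
    ≡⟨ cong (λ (r , s) → disassemble (length r) r s) split ⟩
  disassemble (length rows) rows σ
    ≡⟨ cong (λ k → disassemble k rows σ) length-rows ⟩
  zip (differences (map (_∸ suc l) rows)) (smallPartCode l σ)
    ≡⟨ cong₂ zip (trans (cong differences shifted) (differences-suffixSums us)) code ⟩
  zip us vs
    ≡⟨ zip-unzip M ⟩
  M ∎
  where
  open ≡-Reasoning
  l = length M
  us = firsts M
  vs = seconds M
  rows = rowsOf l us
  σ = smallPart l vs
  length-rows : length rows ≡ l
  length-rows = trans (length-rowsOf l us) (length-firsts M)
  split : splitRows 1 (rows ++ σ) ≡ (rows , σ)
  split = splitRows-exact 1 rows σ
    (All.map (≤-trans (≤-reflexive (cong suc length-rows))) (rowsOf-big l us))
    (All.map (λ p → ≤-trans p (≤-reflexive (sym (cong suc length-rows))))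
      (smallPart-bounded l vs (length-seconds M)))
  shifted : map (_∸ suc l) rows ≡ suffixSums us
  shifted = trans (sym (map-∘ (suffixSums us)))
                  (map-id-local (All.universal (m+n∸m≡n (suc l)) (suffixSums us)))
  code : smallPartCode l σ ≡ vs
  code = subst (λ k → smallPartCode k (smallPart k vs) ≡ vs) (length-seconds M)
               (smallPartCode-smallPart vs)

-- On partitions with non-negative crank, decoding the code gives the partition back;
-- the crank condition is what makes the small part invertible.
pairsToCrank-crankToPairs : ∀ π → IsPartition π → ℤ.+ 0 ℤ.≤ crank π →
                            pairsToCrank (crankToPairs π) ≡ π
pairsToCrank-crankToPairs π (d , pos) 0≤crank = begin
  assemble (length M) (firsts M) (seconds M)
    ≡⟨ cong₂ (λ k (us , vs) → assemble k us vs) (trans length-M length-gs)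
             (cong₂ _,_ firsts-M seconds-M) ⟩
  rowsOf l gs ++ smallPart l es
    ≡⟨ cong₂ _++_ (rowsOf-differences l rows d-rows big)
                  (smallPart-smallPartCode l σ d-σ pos-σ small few-ones) ⟩
  rows ++ σ
    ≡⟨ splitRows-++ 1 π ⟩
  π ∎
  where
  open ≡-Reasoning
  rows = proj₁ (splitRows 1 π)
  σ = proj₂ (splitRows 1 π)
  l = length rows
  big : All (suc l ≤_) rows
  big = proj₁ (splitRows-bounds 1 π d)
  small : All (_≤ suc l) σ
  small = proj₂ (splitRows-bounds 1 π d)
  d-rows++σ : Decreasing (rows ++ σ)
  d-rows++σ = subst Decreasing (sym (splitRows-++ 1 π)) d
  d-rows : Decreasing rows
  d-rows = decreasing-++ˡ rows d-rows++σ
  d-σ : Decreasing σ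
  d-σ = decreasing-++ʳ rows d-rows++σ
  pos-σ : All (1 ≤_) σ
  pos-σ = AllP.++⁻ʳ rows (subst (All (1 ≤_)) (sym (splitRows-++ 1 π)) pos)
  few-ones : ω σ ≤ l
  few-ones = RowsAboveSmallPart.few-ones-if-crank-nonneg l rows σ refl big small
    (subst (λ xs → ℤ.+ 0 ℤ.≤ crank xs) (sym (splitRows-++ 1 π)) 0≤crank)
  gs = differences (map (_∸ suc l) rows)
  es = smallPartCode l σ
  M = zip gs es
  length-gs : length gs ≡ l
  length-gs = trans (length-differences (map (_∸ suc l) rows)) (length-map (_∸ suc l) rows)
  components = zip-components gs es (trans length-gs (sym (length-smallPartCode l σ)))
  length-M : length M ≡ length gs
  length-M = proj₁ components
  firsts-M : firsts M ≡ gs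
  firsts-M = proj₁ (proj₂ components)
  seconds-M : seconds M ≡ es
  seconds-M = proj₂ (proj₂ components)

CrankCondition : ℕ → List ℕ → Set
CrankCondition n xs = IsPartition xs × sum xs ≡ n × ℤ.+ 0 ℤ.≤ crank xs

CrankSide : ℕ → Set
CrankSide n = Σ (List ℕ) (CrankCondition n)

crankCondition-irrelevant : ∀ {n} → IsPropValued (CrankCondition n)
crankCondition-irrelevant ((d , p) , s , c) ((d′ , p′) , s′ , c′) =
  cong₂ _,_ (cong₂ _,_ (Linked.irrelevant ≤-irrelevant d d′) (All.irrelevant ≤-irrelevant p p′))
    (cong₂ _,_ (≡-irrelevant s s′) (ℤP.≤-irrelevant c c′))

pairs↔crank : ∀ n → PairsOfWeight n ↔ CrankSide n
pairs↔crank n = subset-↔ ≡-irrelevant crankCondition-irrelevant pairsToCrank crankToPairs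
  (λ {M} w → pairsToCrank-partition M , trans (pairsToCrank-sum M) w , pairsToCrank-crank M)
  (λ {π} (p , s , c) → trans (sym (pairsToCrank-sum (crankToPairs π)))
     (trans (cong sum (pairsToCrank-crankToPairs π p c)) s))
  (λ {M} _ → crankToPairs-pairsToCrank M)
  (λ {π} (p , _ , c) → pairsToCrank-crankToPairs π p c)
  where
  pairsToCrank-partition : ∀ M → IsPartition (pairsToCrank M)
  pairsToCrank-partition M = assemble-partition (length M) (firsts M) (seconds M) (length-seconds M)
  pairsToCrank-sum : ∀ M → sum (pairsToCrank M) ≡ pairWeight M
  pairsToCrank-sum M = assemble-sum (length M) (firsts M) (seconds M) (length-firsts M)
  pairsToCrank-crank : ∀ M → ℤ.+ 0 ℤ.≤ crank (pairsToCrank M)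
  pairsToCrank-crank M =
    assemble-crank (length M) (firsts M) (seconds M) (length-firsts M) (length-seconds M)

theorem10 : (n : ℕ) →
    (Σ (List ℕ) (λ xs → IsDistinctPartition xs × HasEvenLength xs × oddIndexedSum xs ≡ n))
    ↔ (Σ (List ℕ) (λ xs → IsPartition xs × sum xs ≡ n × ℤ.+ 0 ℤ.≤ crank xs))
theorem10 n = pairs↔crank n ↔-∘ distinct↔pairs n
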